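{- Let $(\mathcal{Y},\eta)$ be an $(n,m)$-voltage operator, let $\mathcal{X}$ be an $n$-premaniplex, and let $\mathrm{Aut}(\mathcal{Y},\eta)$ be the set of $\tau\in\mathrm{Aut}(\mathcal{Y})$ satisfying $\eta(W\tau)=\eta(W)$ for all $W\in\Pi(\mathcal{Y})$. Regard $\mathrm{Aut}(\mathcal{X})$ and $\mathrm{Aut}(\mathcal{Y},\eta)$ as subgroups of $\mathrm{Aut}(\mathcal{X}\rtimes_\eta\mathcal{Y})$ via $\sigma\mapsto[(x,y)\mapsto(x\sigma,y)]$ and $\tau\mapsto[(x,y)\mapsto(x,y\tau)]$ respectively. Then the subgroup they generate is $\langle\mathrm{Aut}(\mathcal{X}),\mathrm{Aut}(\mathcal{Y},\eta)\rangle=\mathrm{Aut}(\mathcal{X})\times\mathrm{Aut}(\mathcal{Y},\eta)$, acting by $(x,y)(\sigma,\tau)=(x\sigma,y\tau)$.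
   Context: A graph may have multiple edges and semi-edges. An $n$-premaniplex is such a graph with edges coloured by $\{0,\dots,n-1\}$ so that every vertex (flag) is the starting point of exactly one dart of each colour, and whenever $|i-j|\ge2$ every alternating path of length 4 with colours $i,j$ is closed; $x^i$ is the end of the $i$-dart at $x$. $\mathcal{C}^n=\langle r_0,\dots,r_{n-1}\mid r_i^2=1,\ (r_ir_j)^2=1\ (|i-j|\ge2)\rangle$ acts on the left on flags by $r_ix=x^i$. Automorphisms are bijections of flags preserving all $i$-adjacencies, acting on the right; an automorphism $\tau$ of $\mathcal{Y}$ maps each path $W$ to a path $W\tau$. For a flag $y$ of an $m$-premaniplex $\mathcal{Y}$ and $\omega\in\mathcal{C}^m$, $P_\omega(y)$ is the homotopy class of paths from $y$ whose successive colours $i_1,\dots,i_k$ satisfy $r_{i_k}\cdots r_{i_1}=\omega$ (homotopic iff same start and same element of $\mathcal{C}^m$); these form the fundamental groupoid $\Pi(\mathcal{Y})$. A voltage assignment $\eta:\Pi(\mathcal{Y})\to\mathcal{C}^n$ satisfies $\eta(W_1W_2)=\eta(W_2)\eta(W_1)$; $(\mathcal{Y},\eta)$ is an $(n,m)$-voltage operator. $\mathcal{X}\rtimes_\eta\mathcal{Y}$ is the $m$-premaniplex with flags $\mathcal{X}\times\mathcal{Y}$ and $(x,y)^i=(\eta(P_{r_i}(y))x,y^i)$. Standing assumption: $\mathcal{Y}$ has a spanning tree (forest if disconnected) all of whose darts have trivial voltage. -}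

module Defs where

open import Data.Nat using (ℕ; _≤_; ∣_-_∣)
open import Data.Fin using (Fin; toℕ)
open import Data.List using (List; []; _∷_; _++_)
open import Data.List.Relation.Unary.Linked using (Linked)
open import Data.Product using (Σ; ∃; _×_; _,_; proj₁; proj₂)
open import Data.Sum using (_⊎_)
open import Data.Unit using (⊤)
open import Relation.Nullary using (¬_)
open import Relation.Binary.PropositionalEquality using (_≡_; sym; trans; cong)

Far : {n : ℕ} → Fin n → Fin n → Set
Far i j = 2 ≤ ∣ toℕ i - toℕ j ∣

-- The group C^n = ⟨ r_0..r_{n-1} | r_i² , (r_i r_j)² (|i-j|≥2) ⟩,
-- presented by words; the list [a₁,…,a_k] denotes r_{a₁} ⋯ r_{a_k},
-- so group multiplication is list concatenation _++_ and equality in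
-- C^n is the congruence _≈ᶜ_ generated by the defining relators.

Word : ℕ → Set
Word n = List (Fin n)

infix 4 _≈ᶜ_
data _≈ᶜ_ {n : ℕ} : Word n → Word n → Set where
  ≈-refl  : ∀ {u} → u ≈ᶜ u
  ≈-sym   : ∀ {u v} → u ≈ᶜ v → v ≈ᶜ u
  ≈-trans : ∀ {u v w} → u ≈ᶜ v → v ≈ᶜ w → u ≈ᶜ w
  rel-sq  : ∀ u v (i : Fin n) → (u ++ i ∷ i ∷ v) ≈ᶜ (u ++ v)
  rel-far : ∀ u v (i j : Fin n) → Far i j →
            (u ++ i ∷ j ∷ i ∷ j ∷ v) ≈ᶜ (u ++ v)

-- Edge-coloured graphs: every flag has exactly one i-dart; adj i x = x^i.

record Coloured (n : ℕ) : Set₁ where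
  field
    Flag : Set
    adj  : Fin n → Flag → Flag

record Premaniplex (n : ℕ) : Set₁ where
  field
    coloured : Coloured n
  open Coloured coloured public
  field
    adj-invol : ∀ i x → adj i (adj i x) ≡ x
    adj-far   : ∀ i j → Far i j → ∀ x → adj i (adj j (adj i (adj j x))) ≡ x


act : ∀ {n} (C : Coloured n) → Word n → Coloured.Flag C → Coloured.Flag C
act C []      x = x
act C (i ∷ w) x = Coloured.adj C i (act C w x)

-- Automorphisms: bijections of flags preserving all i-adjacencies.
-- They act on the right: x σ = fun σ x.

record Aut {n : ℕ} (C : Coloured n) : Set where
  open Coloured C
  field
    fun      : Flag → Flag
    inv      : Flag → Flag
    inv-fun  : ∀ x → inv (fun x) ≡ x
    fun-inv  : ∀ x → fun (inv x) ≡ x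
    preserve : ∀ i x → fun (adj i x) ≡ adj i (fun x)

open Aut public

idAut : ∀ {n} (C : Coloured n) → Aut C
idAut C = record
  { fun = λ x → x ; inv = λ x → x
  ; inv-fun = λ _ → _≡_.refl ; fun-inv = λ _ → _≡_.refl
  ; preserve = λ _ _ → _≡_.refl }

_∙A_ : ∀ {n} {C : Coloured n} → Aut C → Aut C → Aut C
_∙A_ {C = C} σ τ = record
  { fun = λ x → fun τ (fun σ x)
  ; inv = λ x → inv σ (inv τ x)
  ; inv-fun = λ x → trans (cong (inv σ) (inv-fun τ (fun σ x))) (inv-fun σ x)
  ; fun-inv = λ x → trans (cong (fun τ) (fun-inv σ (inv τ x))) (fun-inv τ x)
  ; preserve = λ i x → trans (cong (fun τ) (preserve σ i x))
                             (preserve τ i (fun σ x)) }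

_⁻¹A : ∀ {n} {C : Coloured n} → Aut C → Aut C
_⁻¹A {C = C} σ = record
  { fun = inv σ ; inv = fun σ
  ; inv-fun = fun-inv σ ; fun-inv = inv-fun σ
  ; preserve = λ i x →
      trans (cong (λ z → inv σ (Coloured.adj C i z)) (sym (fun-inv σ x)))
        (trans (cong (inv σ) (sym (preserve σ i (inv σ x))))
               (inv-fun σ (Coloured.adj C i (inv σ x)))) }

-- The homotopy class P_ω(y) of paths from y is
-- represented by the pair (y , ω) with ω ∈ C^m; its end is ω y.
-- Concatenation: P_ω(y) followed by P_ω'(ω y) is P_{ω' ω}(y), so the rule
-- η(W₁W₂) = η(W₂) η(W₁) reads  η y (ω' ++ ω) = η (ω y) ω' ++ η y ω.

record Voltage {m : ℕ} (Y : Premaniplex m) (n : ℕ) : Set where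
  open Premaniplex Y
  field
    η      : Flag → Word m → Word n
    η-resp : ∀ y {ω ω'} → ω ≈ᶜ ω' → η y ω ≈ᶜ η y ω'
    η-comp : ∀ y ω ω' → η y (ω' ++ ω) ≈ᶜ (η (act (Premaniplex.coloured Y) ω y) ω' ++ η y ω)

open Voltage public using (η)

-- Standing assumption: a spanning forest of Y all of whose darts have
-- trivial voltage.  A walk from y is given by its list of colours in
-- traversal order; a set of darts T : Flag → Fin m → Set (the dart of
-- colour i at y) is an edge set if closed under reversal.

module _ {m : ℕ} (Y : Premaniplex m) where
  open Premaniplex Y

  walkEnd : Flag → List (Fin m) → Flag
  walkEnd y []       = y
  walkEnd y (c ∷ cs) = walkEnd (adj c y) cs

  TWalk : (Flag → Fin m → Set) → Flag → List (Fin m) → Set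
  TWalk T y []       = ⊤
  TWalk T y (c ∷ cs) = T y c × TWalk T (adj c y) cs

  -- no immediate backtracking along the same edge
  Reduced : List (Fin m) → Set
  Reduced = Linked (λ a b → ¬ a ≡ b)

  record SpanningForest (T : Flag → Fin m → Set) : Set where
    field
      symmetric : ∀ y i → T y i → T (adj i y) i
      spanning  : ∀ y (w : Word m) →
                  Σ (List (Fin m)) λ cs → TWalk T y cs × walkEnd y cs ≡ act (Premaniplex.coloured Y) w y
      acyclic   : ∀ y cs ds → TWalk T y cs → TWalk T y ds →
                  Reduced cs → Reduced ds → walkEnd y cs ≡ walkEnd y ds → cs ≡ ds

  HasTrivialSpanningForest : ∀ {n} → Voltage Y n → Set₁
  HasTrivialSpanningForest V =
    Σ (Flag → Fin m → Set) λ T → SpanningForest T ×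
      (∀ y i → T y i → η V y (i ∷ []) ≈ᶜ [])

_⋊_ : ∀ {n m} (X : Premaniplex n) {Y : Premaniplex m} → Voltage Y n → Coloured m
_⋊_ X {Y} V = record
  { Flag = Premaniplex.Flag X × Premaniplex.Flag Y
  ; adj  = λ i p → act (Premaniplex.coloured X) (η V (proj₂ p) (i ∷ [])) (proj₁ p)
                 , Premaniplex.adj Y i (proj₂ p) }

-- Aut(Y, η): automorphisms τ of Y with η(W τ) = η(W) for all W ∈ Π(Y).
-- The path P_ω(y) is mapped by τ to P_ω(y τ).
record AutV {n m : ℕ} {Y : Premaniplex m} (V : Voltage Y n) : Set where
  field
    aut   : Aut (Premaniplex.coloured Y)
    η-inv : ∀ y ω → η V (fun aut y) ω ≈ᶜ η V y ω

open AutV public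

-- Subgroup of Aut(C) generated by a set S of automorphisms (automorphisms
-- compared by pointwise equality of their action on flags).

_≗A_ : ∀ {n} {C : Coloured n} → Aut C → Aut C → Set
φ ≗A ψ = ∀ x → fun φ x ≡ fun ψ x

data Generated {n : ℕ} {C : Coloured n} (S : Aut C → Set) : Aut C → Set where
  gen  : ∀ {φ} → S φ → Generated S φ
  gid  : Generated S (idAut C)
  gmul : ∀ {φ ψ} → Generated S φ → Generated S ψ → Generated S (φ ∙A ψ)
  ginv : ∀ {φ} → Generated S φ → Generated S (φ ⁻¹A)
  gext : ∀ {φ ψ} → Generated S φ → φ ≗A ψ → Generated S ψ

module _ {n m : ℕ} (X : Premaniplex n) {Y : Premaniplex m} (V : Voltage Y n) where

  EmbX : Aut (X ⋊ V) → Set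
  EmbX φ = Σ (Aut (Premaniplex.coloured X)) λ σ →
             ∀ x y → fun φ (x , y) ≡ (fun σ x , y)

  EmbY : Aut (X ⋊ V) → Set
  EmbY φ = Σ (AutV V) λ τ →
             ∀ x y → fun φ (x , y) ≡ (x , fun (aut τ) y)

  ActsAsPair : Aut (X ⋊ V) → Aut (Premaniplex.coloured X) → AutV V → Set
  ActsAsPair φ σ τ = ∀ x y → fun φ (x , y) ≡ (fun σ x , fun (aut τ) y)

  DirectProductDecomposition : Set
  DirectProductDecomposition =
    (∀ (σ : Aut (Premaniplex.coloured X)) (τ : AutV V) →
       Σ (Aut (X ⋊ V)) λ φ → ActsAsPair φ σ τ)
    × (∀ (σ σ' : Aut (Premaniplex.coloured X)) (τ τ' : AutV V) →
       (∀ x y → (fun σ x , fun (aut τ) y) ≡ (fun σ' x , fun (aut τ') y)) →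
       (σ ≗A σ') × (aut τ ≗A aut τ'))
    × (∀ (φ : Aut (X ⋊ V)) →
       (Generated (λ ψ → EmbX ψ ⊎ EmbY ψ) φ →
          Σ (Aut (Premaniplex.coloured X)) λ σ → Σ (AutV V) λ τ → ActsAsPair φ σ τ)
       × ((Σ (Aut (Premaniplex.coloured X)) λ σ → Σ (AutV V) λ τ → ActsAsPair φ σ τ) →
          Generated (λ ψ → EmbX ψ ⊎ EmbY ψ) φ))

{-# OPTIONS --safe #-}
module Submission where

-- Automorphisms of X commute with the C^n-action and τ ∈ Aut(Y,η) preserves
-- voltages, so (x,y) ↦ (xσ,yτ) preserves the adjacencies
-- (x,y)^i = (η(P_{r_i}(y))x, y^i) of X ⋊_η Y.  These pair automorphisms are closed
-- under composition and inversion and contain both embedded groups, so they are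
-- exactly the subgroup these generate; evaluating at a fixed flag of the other
-- factor shows that a pair is determined by its action.

open import Defs
open import Data.Nat using (ℕ)
open import Data.List using ([]; _∷_; _++_)
open import Data.Product using (Σ; _×_; _,_; proj₁; proj₂)
open import Data.Sum using (_⊎_; inj₁; inj₂)
open import Relation.Binary.PropositionalEquality

module _ {n : ℕ} (C : Coloured n) where
  open Coloured C

  act-++ : ∀ u v x → act C (u ++ v) x ≡ act C u (act C v x)
  act-++ []      v x = refl
  act-++ (i ∷ u) v x = cong (adj i) (act-++ u v x)

  fun-act : (σ : Aut C) → ∀ w x → fun σ (act C w x) ≡ act C w (fun σ x)
  fun-act σ []      x = refl
  fun-act σ (i ∷ w) x = trans (preserve σ i (act C w x)) (cong (adj i) (fun-act σ w x))

  inv-≡-of-fun-≡ : (φ : Aut C) {g h : Flag → Flag} →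
                   (∀ x → fun φ x ≡ g x) → (∀ x → g (h x) ≡ x) → ∀ x → inv φ x ≡ h x
  inv-≡-of-fun-≡ φ {g} {h} φ≗g gh x = begin
    inv φ x             ≡⟨ cong (inv φ) (gh x) ⟨
    inv φ (g (h x))     ≡⟨ cong (inv φ) (φ≗g (h x)) ⟨
    inv φ (fun φ (h x)) ≡⟨ inv-fun φ (h x) ⟩
    h x                 ∎
    where open ≡-Reasoning

module _ {n : ℕ} (X : Premaniplex n) where
  open Premaniplex X

  act-cong : ∀ {u v} → u ≈ᶜ v → ∀ x → act coloured u x ≡ act coloured v x
  act-cong ≈-refl        x = refl
  act-cong (≈-sym p)     x = sym (act-cong p x)
  act-cong (≈-trans p q) x = trans (act-cong p x) (act-cong q x)
  act-cong (rel-sq u v i) x = begin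
    act coloured (u ++ i ∷ i ∷ v) x           ≡⟨ act-++ coloured u (i ∷ i ∷ v) x ⟩
    act coloured u (adj i (adj i (act coloured v x)))
                                              ≡⟨ cong (act coloured u) (adj-invol i _) ⟩
    act coloured u (act coloured v x)         ≡⟨ act-++ coloured u v x ⟨
    act coloured (u ++ v) x                   ∎
    where open ≡-Reasoning
  act-cong (rel-far u v i j far) x = begin
    act coloured (u ++ i ∷ j ∷ i ∷ j ∷ v) x   ≡⟨ act-++ coloured u (i ∷ j ∷ i ∷ j ∷ v) x ⟩
    act coloured u (adj i (adj j (adj i (adj j (act coloured v x)))))
                                              ≡⟨ cong (act coloured u) (adj-far i j far _) ⟩
    act coloured u (act coloured v x)         ≡⟨ act-++ coloured u v x ⟨
    act coloured (u ++ v) x                   ∎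
    where open ≡-Reasoning

module _ {n m : ℕ} {Y : Premaniplex m} {V : Voltage Y n} where

  idAutV : AutV V
  idAutV = record { aut = idAut (Premaniplex.coloured Y) ; η-inv = λ _ _ → ≈-refl }

  _∙V_ : AutV V → AutV V → AutV V
  τ ∙V τ' = record
    { aut   = aut τ ∙A aut τ'
    ; η-inv = λ y ω → ≈-trans (η-inv τ' (fun (aut τ) y) ω) (η-inv τ y ω) }

  _⁻¹V : AutV V → AutV V
  τ ⁻¹V = record
    { aut   = aut τ ⁻¹A
    ; η-inv = λ y ω → ≈-sym (subst (λ z → η V z ω ≈ᶜ η V (inv (aut τ) y) ω)
                                   (fun-inv (aut τ) y) (η-inv τ (inv (aut τ) y) ω)) }

module _ {n m : ℕ} (X : Premaniplex n) {Y : Premaniplex m} (V : Voltage Y n) where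
  private
    CX = Premaniplex.coloured X

  pairAut : Aut CX → AutV V → Aut (X ⋊ V)
  pairAut σ τ = record
    { fun      = λ (x , y) → fun σ x , fun (aut τ) y
    ; inv      = λ (x , y) → inv σ x , inv (aut τ) y
    ; inv-fun  = λ (x , y) → cong₂ _,_ (inv-fun σ x) (inv-fun (aut τ) y)
    ; fun-inv  = λ (x , y) → cong₂ _,_ (fun-inv σ x) (fun-inv (aut τ) y)
    ; preserve = λ i (x , y) → cong₂ _,_
        (trans (fun-act CX σ (η V y (i ∷ [])) x)
               (act-cong X (≈-sym (η-inv τ y (i ∷ []))) (fun σ x)))
        (preserve (aut τ) i y) }

  pairAut-injective : Premaniplex.Flag X → Premaniplex.Flag Y →
    (σ σ' : Aut CX) (τ τ' : AutV V) →
    (∀ x y → (fun σ x , fun (aut τ) y) ≡ (fun σ' x , fun (aut τ') y)) →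
    (σ ≗A σ') × (aut τ ≗A aut τ')
  pairAut-injective x₀ y₀ σ σ' τ τ' eq =
    (λ x → cong proj₁ (eq x y₀)) , (λ y → cong proj₂ (eq x₀ y))

  Embedded : Aut (X ⋊ V) → Set
  Embedded ψ = EmbX X V ψ ⊎ EmbY X V ψ

  ActsAsSomePair : Aut (X ⋊ V) → Set
  ActsAsSomePair φ = Σ (Aut CX) λ σ → Σ (AutV V) λ τ → ActsAsPair X V φ σ τ

  ActsAsSomePair-∙A : ∀ {φ ψ} → ActsAsSomePair φ → ActsAsSomePair ψ → ActsAsSomePair (φ ∙A ψ)
  ActsAsSomePair-∙A {ψ = ψ} (σ , τ , φ≗) (σ' , τ' , ψ≗) =
    σ ∙A σ' , τ ∙V τ' , λ x y → trans (cong (fun ψ) (φ≗ x y)) (ψ≗ _ _)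

  ActsAsSomePair-⁻¹A : ∀ {φ} → ActsAsSomePair φ → ActsAsSomePair (φ ⁻¹A)
  ActsAsSomePair-⁻¹A {φ} (σ , τ , φ≗) =
    σ ⁻¹A , τ ⁻¹V , λ x y →
      inv-≡-of-fun-≡ (X ⋊ V) φ (λ (x , y) → φ≗ x y)
        (λ (x , y) → cong₂ _,_ (fun-inv σ x) (fun-inv (aut τ) y)) (x , y)

  ActsAsSomePair-≗A : ∀ {φ ψ} → ActsAsSomePair φ → φ ≗A ψ → ActsAsSomePair ψ
  ActsAsSomePair-≗A (σ , τ , φ≗) φ≗ψ = σ , τ , λ x y → trans (sym (φ≗ψ (x , y))) (φ≗ x y)

  generated⇒ActsAsSomePair : ∀ {φ} → Generated Embedded φ → ActsAsSomePair φ
  generated⇒ActsAsSomePair (gen (inj₁ (σ , φ≗))) = σ , idAutV , φ≗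
  generated⇒ActsAsSomePair (gen (inj₂ (τ , φ≗))) = idAut CX , τ , φ≗
  generated⇒ActsAsSomePair gid                   = idAut CX , idAutV , λ _ _ → refl
  generated⇒ActsAsSomePair (gmul {φ} {ψ} g h)    =
    ActsAsSomePair-∙A {φ} {ψ} (generated⇒ActsAsSomePair g) (generated⇒ActsAsSomePair h)
  generated⇒ActsAsSomePair (ginv {φ} g)          =
    ActsAsSomePair-⁻¹A {φ} (generated⇒ActsAsSomePair g)
  generated⇒ActsAsSomePair (gext {φ} {ψ} g φ≗ψ)  =
    ActsAsSomePair-≗A {φ} {ψ} (generated⇒ActsAsSomePair g) φ≗ψ

  ActsAsSomePair⇒generated : ∀ {φ} → ActsAsSomePair φ → Generated Embedded φ
  ActsAsSomePair⇒generated (σ , τ , φ≗) =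
    gext (gmul (gen {φ = pairAut σ idAutV} (inj₁ (σ , λ _ _ → refl)))
               (gen {φ = pairAut (idAut CX) τ} (inj₂ (τ , λ _ _ → refl))))
         (λ (x , y) → sym (φ≗ x y))

corollary6p2 : ∀ {n m : ℕ} (Y : Premaniplex m) (V : Voltage Y n) →
    HasTrivialSpanningForest Y V →
    (X : Premaniplex n) →
    Premaniplex.Flag X → Premaniplex.Flag Y →
    DirectProductDecomposition X V
corollary6p2 Y V _ X x₀ y₀ =
    (λ σ τ → pairAut X V σ τ , λ _ _ → refl)
  , pairAut-injective X V x₀ y₀
  , λ φ → generated⇒ActsAsSomePair X V , ActsAsSomePair⇒generated X V
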